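{- For every closed term $M$ of the $\partial_0\lambda$-calculus with tests, either $\tau[M]\twoheadrightarrow\varepsilon$ or $\tau[M]\twoheadrightarrow0$.
   Context: Syntax of the $\partial_0\lambda$-calculus with tests. Terms $M,N,L$, bags $P$ and tests $V,W$ are given by $M ::= x \mid \lambda x.M \mid MP \mid \bar\tau(V)$, $P ::= [L_1,\dots,L_k]$, $V ::= \tau[L_1,\dots,L_k]$ ($k\ge 0$), where bags and tests are finite multisets of terms (the tag $\tau$ distinguishes tests from bags); expressions are taken up to $\alpha$-equivalence. $\uplus$ denotes union of bags; for tests, $\varepsilon:=\tau[\,]$ and $V\mid W$ is multiset union. For each sort, sums are finite formal sums with idempotent addition (finite sets), $0$ being the empty sum. All constructors are extended to sums by multilinearity (e.g. $\lambda x.\sum_i M_i=\sum_i\lambda x.M_i$, $(\sum_i M_i)(\sum_j P_j)=\sum_{i,j}M_iP_j$, $[\sum_i L_i]\uplus P=\sum_i[L_i]\uplus P$, $\tau[\sum_iM_i]\mid V=\sum_i\tau[M_i]\mid V$); constructors applied to $0$ give $0$. $A\{0/x\}=0$ if $x$ is free in $A$ and $A\{0/x\}=A$ otherwise. Linear substitution: $x\langle N/x\rangle=N$; $y\langle N/x\rangle=0$ for $y\neq x$; $(\lambda y.M)\langle N/x\rangle=\lambda y.M\langle N/x\rangle$; $(MP)\langle N/x\rangle=M\langle N/x\rangle P+M(P\langle N/x\rangle)$; $\bar\tau(V)\langle N/x\rangle=\bar\tau(V\langle N/x\rangle)$; $[L_1,\dots,L_k]\langle N/x\rangle=\sum_{i}[L_1,\dots,L_i\langle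 N/x\rangle,\dots,L_k]$ and likewise for tests. For $P=[L_1,\dots,L_k]$ with $x$ not free in $P$, $A\langle P/x\rangle:=A\langle L_1/x\rangle\cdots\langle L_k/x\rangle$. Reduction: base rules $(\lambda x.M)P\to M\langle P/x\rangle\{0/x\}$; $\bar\tau(V)P\to\bar\tau(V)$ if $P=[\,]$ and $\to0$ otherwise; $\tau[\lambda x.M]\mid V\to\tau[M\{0/x\}]\mid V$; $\tau[\bar\tau(V)]\mid W\to V\mid W$. The relation $\to$ on sums is the closure of these rules under every syntactic position (body of a $\lambda$, either side of an application, an element of a bag, inside $\bar\tau$, an element of a test) and under sums ($A+\mathbb B\to\mathbb A+\mathbb B$ if $A\to\mathbb A$); $\twoheadrightarrow$ is its reflexive-transitive closure. -}

module Defs where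

-- ∂₀λ-calculus with tests, de Bruijn syntax (α-equivalence is syntactic identity).
-- Bags and tests (finite multisets of terms) are represented as lists; all reduction
-- rules below are stated position-independently, so the order of list elements is
-- immaterial. Sums (finite sets, idempotent +) are lists compared by set equality _≋_.

open import Data.Nat using (ℕ; zero; suc)
open import Data.Fin using (Fin; zero; suc; _≟_)
open import Data.List using (List; []; _∷_; _++_; map; concatMap; mapMaybe)
open import Data.List.Relation.Binary.Subset.Propositional using (_⊆_)
open import Data.Maybe using (Maybe; just; nothing)
open import Data.Bool using (if_then_else_)
open import Data.Product using (_×_; ∃-syntax)
open import Relation.Nullary using (does)
open import Relation.Binary.Construct.Closure.ReflexiveTransitive using (Star)

data Term (n : ℕ) : Set where
  var : Fin n → Term n
  lam : Term (suc n) → Term n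
  app : Term n → List (Term n) → Term n
  τ̄   : List (Term n) → Term n

Bag : ℕ → Set
Bag n = List (Term n)

Test : ℕ → Set
Test n = List (Term n)

Sum : Set → Set
Sum A = List A

_≋_ : {A : Set} → Sum A → Sum A → Set
𝔸 ≋ 𝔹 = (𝔸 ⊆ 𝔹) × (𝔹 ⊆ 𝔸)

ε : {n : ℕ} → Test n
ε = []

lift : {m n : ℕ} → (Fin m → Fin n) → Fin (suc m) → Fin (suc n)
lift f zero = zero
lift f (suc i) = suc (f i)

mutual
  ren : {m n : ℕ} → (Fin m → Fin n) → Term m → Term n
  ren f (var i) = var (f i)
  ren f (lam M) = lam (ren (lift f) M)
  ren f (app M P) = app (ren f M) (renL f P)
  ren f (τ̄ V) = τ̄ (renL f V)

  renL : {m n : ℕ} → (Fin m → Fin n) → List (Term m) → List (Term n)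
  renL f [] = []
  renL f (L ∷ P) = ren f L ∷ renL f P

wk : {n : ℕ} → Term n → Term (suc n)
wk = ren suc

-- Partial renaming (used for A{0/x}: fails exactly when x occurs free)
liftP : {m n : ℕ} → (Fin m → Maybe (Fin n)) → Fin (suc m) → Maybe (Fin (suc n))
liftP f zero = just zero
liftP f (suc i) = Data.Maybe.map suc (f i)

mutual
  pren : {m n : ℕ} → (Fin m → Maybe (Fin n)) → Term m → Maybe (Term n)
  pren f (var i) = Data.Maybe.map var (f i)
  pren f (lam M) = Data.Maybe.map lam (pren (liftP f) M)
  pren f (app M P) with pren f M | prenL f P
  ... | just M' | just P' = just (app M' P')
  ... | _ | _ = nothing
  pren f (τ̄ V) = Data.Maybe.map τ̄ (prenL f V)

  prenL : {m n : ℕ} → (Fin m → Maybe (Fin n)) → List (Term m) → Maybe (List (Term n))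
  prenL f [] = just []
  prenL f (L ∷ P) with pren f L | prenL f P
  ... | just L' | just P' = just (L' ∷ P')
  ... | _ | _ = nothing

drop0 : {n : ℕ} → Fin (suc n) → Maybe (Fin n)
drop0 zero = nothing
drop0 (suc i) = just i

-- 𝕄{0/x} for x the outermost-bound variable (de Bruijn index 0), on sums:
-- summands where x is free become 0, the others are kept (with x removed from scope).
zeroS : {n : ℕ} → Sum (Term (suc n)) → Sum (Term n)
zeroS = mapMaybe (pren drop0)

mutual
  lsub : {m : ℕ} → Term m → Fin m → Term m → Sum (Term m)
  lsub (var y) x N = if does (y ≟ x) then N ∷ [] else []
  lsub (lam M) x N = map lam (lsub M (suc x) (wk N))
  lsub (app M P) x N = map (λ M' → app M' P) (lsub M x N) ++ map (app M) (lsubL P x N)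
  lsub (τ̄ V) x N = map τ̄ (lsubL V x N)

  lsubL : {m : ℕ} → List (Term m) → Fin m → Term m → Sum (List (Term m))
  lsubL [] x N = []
  lsubL (L ∷ P) x N = map (λ L' → L' ∷ P) (lsub L x N) ++ map (L ∷_) (lsubL P x N)

lsubBag : {m : ℕ} → Sum (Term m) → Fin m → Bag m → Sum (Term m)
lsubBag 𝕄 x [] = 𝕄
lsubBag 𝕄 x (L ∷ P) = lsubBag (concatMap (λ M → lsub M x L) 𝕄) x P

mutual
  data _⟶_ {n : ℕ} : Term n → Sum (Term n) → Set where
    β      : (M : Term (suc n)) (P : Bag n) →
             app (lam M) P ⟶ zeroS (lsubBag (M ∷ []) zero (map wk P))
    τ̄-nil  : (V : Test n) → app (τ̄ V) [] ⟶ (τ̄ V ∷ [])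
    τ̄-cons : (V : Test n) (L : Term n) (P : Bag n) → app (τ̄ V) (L ∷ P) ⟶ []
    ξ-lam  : {M : Term (suc n)} {𝕄 : Sum (Term (suc n))} → M ⟶ 𝕄 → lam M ⟶ map lam 𝕄
    ξ-appL : {M : Term n} {𝕄 : Sum (Term n)} (P : Bag n) →
             M ⟶ 𝕄 → app M P ⟶ map (λ M' → app M' P) 𝕄
    ξ-appR : (M : Term n) {P : Bag n} {ℙ : Sum (Bag n)} →
             P ⟶b ℙ → app M P ⟶ map (app M) ℙ
    ξ-τ̄    : {V : Test n} {𝕍 : Sum (Test n)} → V ⟶t 𝕍 → τ̄ V ⟶ map τ̄ 𝕍

  data _⟶b_ {n : ℕ} : Bag n → Sum (Bag n) → Set where
    ξ-bag : (U W : Bag n) {L : Term n} {𝕃 : Sum (Term n)} →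
            L ⟶ 𝕃 → (U ++ L ∷ W) ⟶b map (λ L' → U ++ L' ∷ W) 𝕃

  data _⟶t_ {n : ℕ} : Test n → Sum (Test n) → Set where
    τ-lam  : (U W : Test n) (M : Term (suc n)) →
             (U ++ lam M ∷ W) ⟶t map (λ M' → U ++ M' ∷ W) (zeroS (M ∷ []))
    τ-τ̄    : (U W : Test n) (V : Test n) → (U ++ τ̄ V ∷ W) ⟶t ((U ++ V ++ W) ∷ [])
    ξ-test : (U W : Test n) {L : Term n} {𝕃 : Sum (Term n)} →
             L ⟶ 𝕃 → (U ++ L ∷ W) ⟶t map (λ L' → U ++ L' ∷ W) 𝕃

data _⟶ts_ {n : ℕ} : Sum (Test n) → Sum (Test n) → Set where
  sum-step : {𝔸 𝔹 ℂ : Sum (Test n)} {A : Test n} {𝔸' : Sum (Test n)} →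
             𝔸 ≋ (A ∷ ℂ) → A ⟶t 𝔸' → 𝔹 ≋ (𝔸' ++ ℂ) → 𝔸 ⟶ts 𝔹

_↠t_ : {n : ℕ} → Sum (Test n) → Sum (Test n) → Set
𝔸 ↠t 𝔹 = ∃[ ℂ ] (Star _⟶ts_ 𝔸 ℂ × ℂ ≋ 𝔹)

-- A closed term is a λ or a τ̄ applied to zero or more bags, so a closed
-- nonempty test τ[L] | W always has a redex at the head of L. Firing it yields a sum
-- each of whose summands has fewer constructors than the test: linear substitution
-- consumes one variable occurrence for every bag element it substitutes, and A{0/x}
-- only renames or discards. By well-founded induction on size, every closed test
-- therefore reduces to a sum of copies of ε, which by idempotence of + is ε or 0.
module Submission where

open import Defs
open import Data.Bool using (Bool; true; false; _∨_)
open import Data.Fin using (Fin; zero; suc; _≟_)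
open import Data.List using (List; []; _∷_; _++_; map; concatMap; mapMaybe)
open import Data.List.Membership.Propositional using (_∈_; find)
open import Data.List.Membership.Propositional.Properties using (∈-map⁻; ∈-++⁻; ∈-concatMap⁻)
open import Data.List.Properties using (++-assoc; ++-identityʳ)
open import Data.List.Relation.Binary.Permutation.Propositional.Properties using (++-comm)
open import Data.List.Relation.Binary.Subset.Propositional.Properties
  using (⊆-refl; ⊆-trans; ⊆-reflexive-↭; ++⁺)
open import Data.List.Relation.Unary.Any using (here; there)
open import Data.Maybe using (Maybe; just; nothing)
open import Data.Nat using (ℕ; suc; _+_; _≤_; _<_; s≤s)
open import Data.Nat.Induction using (<-wellFounded)
open import Data.Nat.Properties
  using (≤-refl; ≤-reflexive; <⇒≤; <-≤-trans; n<1+n; m≤m+n; +-assoc; +-identityʳ;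
         +-monoˡ-≤; +-monoˡ-<; +-monoʳ-<; +-commutativeSemigroup; module ≤-Reasoning)
open import Algebra.Properties.CommutativeSemigroup +-commutativeSemigroup using (xy∙z≈xz∙y)
open import Data.Product using (∃; ∃-syntax; _×_; _,_)
open import Data.Sum using (_⊎_; inj₁; inj₂)
open import Function using (_∘_)
import Induction.WellFounded as WF
open import Level using (0ℓ)
open import Relation.Binary.Construct.Closure.ReflexiveTransitive
  using (_◅_; _◅◅_; gmap) renaming (ε to ε★)
import Relation.Binary.Construct.On as On
open import Relation.Binary.PropositionalEquality using (_≡_; refl; sym; cong; cong₂; subst; trans)
open import Relation.Nullary using (does)

mutual
  size : {n : ℕ} → Term n → ℕ
  size (var _)   = 1
  size (lam M)   = suc (size M)
  size (app M P) = suc (size M + sizeL P)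
  size (τ̄ V)     = suc (sizeL V)

  sizeL : {n : ℕ} → List (Term n) → ℕ
  sizeL []      = 0
  sizeL (L ∷ P) = size L + sizeL P

sizeL-++ : {n : ℕ} (U W : List (Term n)) → sizeL (U ++ W) ≡ sizeL U + sizeL W
sizeL-++ []      W = refl
sizeL-++ (L ∷ U) W =
  trans (cong (size L +_) (sizeL-++ U W)) (sym (+-assoc (size L) (sizeL U) (sizeL W)))

mutual
  size-ren : {m n : ℕ} (f : Fin m → Fin n) (M : Term m) → size (ren f M) ≡ size M
  size-ren f (var i)   = refl
  size-ren f (lam M)   = cong suc (size-ren (lift f) M)
  size-ren f (app M P) = cong suc (cong₂ _+_ (size-ren f M) (sizeL-renL f P))
  size-ren f (τ̄ V)     = cong suc (sizeL-renL f V)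

  sizeL-renL : {m n : ℕ} (f : Fin m → Fin n) (P : List (Term m)) → sizeL (renL f P) ≡ sizeL P
  sizeL-renL f []      = refl
  sizeL-renL f (L ∷ P) = cong₂ _+_ (size-ren f L) (sizeL-renL f P)

sizeL-map-wk : {n : ℕ} (P : List (Term n)) → sizeL (map wk P) ≡ sizeL P
sizeL-map-wk []      = refl
sizeL-map-wk (L ∷ P) = cong₂ _+_ (size-ren suc L) (sizeL-map-wk P)

mutual
  size-pren : {m n : ℕ} (f : Fin m → Maybe (Fin n)) (M : Term m) {M′ : Term n} →
              pren f M ≡ just M′ → size M′ ≡ size M
  size-pren f (var i) eq with f i | eq
  ... | just _  | refl = refl
  ... | nothing | ()
  size-pren f (lam M) eq with pren (liftP f) M in eqM | eq
  ... | just _  | refl = cong suc (size-pren (liftP f) M eqM)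
  ... | nothing | ()
  size-pren f (app M P) eq with pren f M in eqM | prenL f P in eqP | eq
  ... | just _  | just _  | refl = cong suc (cong₂ _+_ (size-pren f M eqM) (sizeL-prenL f P eqP))
  ... | just _  | nothing | ()
  ... | nothing | _       | ()
  size-pren f (τ̄ V) eq with prenL f V in eqV | eq
  ... | just _  | refl = cong suc (sizeL-prenL f V eqV)
  ... | nothing | ()

  sizeL-prenL : {m n : ℕ} (f : Fin m → Maybe (Fin n)) (P : List (Term m)) {P′ : List (Term n)} →
                prenL f P ≡ just P′ → sizeL P′ ≡ sizeL P
  sizeL-prenL f [] refl = refl
  sizeL-prenL f (L ∷ P) eq with pren f L in eqL | prenL f P in eqP | eq
  ... | just _  | just _  | refl = cong₂ _+_ (size-pren f L eqL) (sizeL-prenL f P eqP)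
  ... | just _  | nothing | ()
  ... | nothing | _       | ()

∈-mapMaybe⁻ : {A B : Set} (f : A → Maybe B) {xs : List A} {y : B} →
              y ∈ mapMaybe f xs → ∃ λ x → x ∈ xs × f x ≡ just y
∈-mapMaybe⁻ f {x ∷ xs} y∈ with f x in eq | y∈
... | just _  | here refl = x , here refl , eq
... | just _  | there y∈′ = let x′ , x′∈ , eq′ = ∈-mapMaybe⁻ f y∈′ in x′ , there x′∈ , eq′
... | nothing | y∈′       = let x′ , x′∈ , eq′ = ∈-mapMaybe⁻ f y∈′ in x′ , there x′∈ , eq′

size-∈-zeroS : {n : ℕ} {𝕄 : Sum (Term (suc n))} {T : Term n} →
               T ∈ zeroS 𝕄 → ∃ λ M → M ∈ 𝕄 × size T ≡ size M
size-∈-zeroS T∈ = let M , M∈ , eq = ∈-mapMaybe⁻ (pren drop0) T∈ in M , M∈ , size-pren drop0 M eq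

a<b+d⇒a+c<b+c+d : ∀ {a b} c d → a < b + d → a + c < b + c + d
a<b+d⇒a+c<b+c+d {a} {b} c d h = subst (a + c <_) (xy∙z≈xz∙y b d c) (+-monoˡ-< c h)

a<b+d⇒c+a<c+b+d : ∀ {a b} c d → a < b + d → c + a < c + b + d
a<b+d⇒c+a<c+b+d {a} {b} c d h = subst (c + a <_) (sym (+-assoc c b d)) (+-monoʳ-< c h)

mutual
  size-lsub : {m : ℕ} (M : Term m) (x : Fin m) (N : Term m) {T : Term m} →
              T ∈ lsub M x N → size T < size M + size N
  size-lsub (var y) x N T∈ with does (y ≟ x) | T∈
  ... | true | here refl = ≤-refl
  size-lsub (lam M) x N T∈ with ∈-map⁻ lam T∈
  ... | T′ , T′∈ , refl =
    s≤s (subst (λ k → size T′ < size M + k) (size-ren suc N) (size-lsub M (suc x) (wk N) T′∈))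
  size-lsub (app M P) x N T∈ with ∈-++⁻ (map (λ M′ → app M′ P) (lsub M x N)) T∈
  ... | inj₁ T∈ˡ with ∈-map⁻ (λ M′ → app M′ P) T∈ˡ
  ...   | M′ , M′∈ , refl = s≤s (a<b+d⇒a+c<b+c+d (sizeL P) (size N) (size-lsub M x N M′∈))
  size-lsub (app M P) x N T∈ | inj₂ T∈ʳ with ∈-map⁻ (app M) T∈ʳ
  ...   | P′ , P′∈ , refl = s≤s (a<b+d⇒c+a<c+b+d (size M) (size N) (sizeL-lsubL P x N P′∈))
  size-lsub (τ̄ V) x N T∈ with ∈-map⁻ τ̄ T∈
  ... | V′ , V′∈ , refl = s≤s (sizeL-lsubL V x N V′∈)

  sizeL-lsubL : {m : ℕ} (P : List (Term m)) (x : Fin m) (N : Term m) {T : List (Term m)} →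
                T ∈ lsubL P x N → sizeL T < sizeL P + size N
  sizeL-lsubL (L ∷ P) x N T∈ with ∈-++⁻ (map (λ L′ → L′ ∷ P) (lsub L x N)) T∈
  ... | inj₁ T∈ˡ with ∈-map⁻ (λ L′ → L′ ∷ P) T∈ˡ
  ...   | L′ , L′∈ , refl = a<b+d⇒a+c<b+c+d (sizeL P) (size N) (size-lsub L x N L′∈)
  sizeL-lsubL (L ∷ P) x N T∈ | inj₂ T∈ʳ with ∈-map⁻ (L ∷_) T∈ʳ
  ...   | P′ , P′∈ , refl = a<b+d⇒c+a<c+b+d (size L) (size N) (sizeL-lsubL P x N P′∈)

size-lsubBag : {m : ℕ} (𝕄 : Sum (Term m)) (x : Fin m) (P : Bag m) {k : ℕ} →
               (∀ {M} → M ∈ 𝕄 → size M ≤ k) → ∀ {T} → T ∈ lsubBag 𝕄 x P → size T ≤ k + sizeL P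
size-lsubBag 𝕄 x []      {k} bound {T} T∈ = subst (size T ≤_) (sym (+-identityʳ k)) (bound T∈)
size-lsubBag 𝕄 x (L ∷ P) {k} bound {T} T∈ =
  subst (size T ≤_) (+-assoc k (size L) (sizeL P)) (size-lsubBag _ x P bound′ T∈)
  where
  bound′ : ∀ {M′} → M′ ∈ concatMap (λ M → lsub M x L) 𝕄 → size M′ ≤ k + size L
  bound′ M′∈ with find (∈-concatMap⁻ (λ M → lsub M x L) M′∈)
  ... | M , M∈ , M′∈lsub = <⇒≤ (<-≤-trans (size-lsub M x L M′∈lsub) (+-monoˡ-≤ (size L) (bound M∈)))

size-β : {n : ℕ} (M : Term (suc n)) (P : Bag n) {T : Term n} →
         T ∈ zeroS (lsubBag (M ∷ []) zero (map wk P)) → size T < size (app (lam M) P)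
size-β M P {T} T∈ with size-∈-zeroS T∈
... | M′ , M′∈ , eq = begin-strict
  size T                         ≡⟨ eq ⟩
  size M′                        ≤⟨ size-lsubBag (M ∷ []) zero (map wk P) (λ { (here refl) → ≤-refl }) M′∈ ⟩
  size M + sizeL (map wk P)      ≡⟨ cong (size M +_) (sizeL-map-wk P) ⟩
  size M + sizeL P               <⟨ n<1+n _ ⟩
  suc (size M + sizeL P)         <⟨ n<1+n _ ⟩
  size (app (lam M) P)           ∎
  where open ≤-Reasoning

ShrinkingStep : {A : Set} → (A → Sum A → Set) → (A → ℕ) → A → Set
ShrinkingStep _↝_ μ a = ∃[ 𝔸 ] (a ↝ 𝔸 × (∀ {b} → b ∈ 𝔸 → μ b < μ a))

map-smaller : {A B : Set} (μ : A → ℕ) (ν : B → ℕ) (f : A → B) →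
              (∀ {a a′} → μ a′ < μ a → ν (f a′) < ν (f a)) →
              (a : A) {𝔸 : Sum A} → (∀ {a′} → a′ ∈ 𝔸 → μ a′ < μ a) →
              ∀ {b} → b ∈ map f 𝔸 → ν b < ν (f a)
map-smaller μ ν f mono a smaller b∈ with ∈-map⁻ f b∈
... | a′ , a′∈ , refl = mono (smaller a′∈)

closed-app-shrinks : (N : Term 0) (P : Bag 0) → ShrinkingStep _⟶_ size (app N P)
closed-app-shrinks (lam M) P     = _ , β M P , size-β M P
closed-app-shrinks (τ̄ V) []      = _ , τ̄-nil V , λ { (here refl) → s≤s (m≤m+n _ 0) }
closed-app-shrinks (τ̄ V) (L ∷ P) = _ , τ̄-cons V L P , λ ()
closed-app-shrinks (app N Q) P with closed-app-shrinks N Q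
... | _ , step , smaller =
  _ , ξ-appL P step ,
  map-smaller size size (λ M → app M P) (λ lt → s≤s (+-monoˡ-< (sizeL P) lt)) (app N Q) smaller

closed-test-shrinks : (L : Term 0) (W : Test 0) → ShrinkingStep _⟶t_ sizeL (L ∷ W)
closed-test-shrinks (lam M) W =
  _ , τ-lam [] W M , map-smaller size sizeL (_∷ W) (+-monoˡ-< (sizeL W)) (lam M) body-smaller
  where
  body-smaller : ∀ {M′} → M′ ∈ zeroS (M ∷ []) → size M′ < size (lam M)
  body-smaller M′∈ with size-∈-zeroS {𝕄 = M ∷ []} M′∈
  ... | _ , here refl , eq = s≤s (≤-reflexive eq)
  ... | _ , there () , _
closed-test-shrinks (τ̄ V) W = _ , τ-τ̄ [] W V , λ { (here refl) → s≤s (≤-reflexive (sizeL-++ V W)) }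
closed-test-shrinks (app N P) W with closed-app-shrinks N P
... | _ , step , smaller =
  _ , ξ-test [] W step , map-smaller size sizeL (_∷ W) (+-monoˡ-< (sizeL W)) (app N P) smaller

module _ {A : Set} where

  ≋-refl : {𝔸 : Sum A} → 𝔸 ≋ 𝔸
  ≋-refl = ⊆-refl , ⊆-refl

  ≋-reflexive : {𝔸 𝔹 : Sum A} → 𝔸 ≡ 𝔹 → 𝔸 ≋ 𝔹
  ≋-reflexive refl = ≋-refl

  ≋-trans : {𝔸 𝔹 ℂ : Sum A} → 𝔸 ≋ 𝔹 → 𝔹 ≋ ℂ → 𝔸 ≋ ℂ
  ≋-trans (p , q) (r , s) = ⊆-trans p r , ⊆-trans s q

  ++-cong-≋ : {𝔸 𝔸′ 𝔹 𝔹′ : Sum A} → 𝔸 ≋ 𝔸′ → 𝔹 ≋ 𝔹′ → (𝔸 ++ 𝔹) ≋ (𝔸′ ++ 𝔹′)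
  ++-cong-≋ (p , q) (r , s) = ++⁺ p r , ++⁺ q s

  ++-comm-≋ : (𝔸 𝔹 : Sum A) → (𝔸 ++ 𝔹) ≋ (𝔹 ++ 𝔸)
  ++-comm-≋ 𝔸 𝔹 = ⊆-reflexive-↭ (++-comm 𝔸 𝔹) , ⊆-reflexive-↭ (++-comm 𝔹 𝔸)

module _ {n : ℕ} where

  ⟶ts-respˡ-≋ : {𝔸 𝔸′ 𝔹 : Sum (Test n)} → 𝔸′ ≋ 𝔸 → 𝔸 ⟶ts 𝔹 → 𝔸′ ⟶ts 𝔹
  ⟶ts-respˡ-≋ p (sum-step e s e′) = sum-step (≋-trans p e) s e′

  ⟶ts-respʳ-≋ : {𝔸 𝔹 𝔹′ : Sum (Test n)} → 𝔹′ ≋ 𝔹 → 𝔸 ⟶ts 𝔹 → 𝔸 ⟶ts 𝔹′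
  ⟶ts-respʳ-≋ p (sum-step e s e′) = sum-step e s (≋-trans p e′)

  ⟶ts-++ʳ : {𝔸 𝔹 : Sum (Test n)} (𝔻 : Sum (Test n)) → 𝔸 ⟶ts 𝔹 → (𝔸 ++ 𝔻) ⟶ts (𝔹 ++ 𝔻)
  ⟶ts-++ʳ 𝔻 (sum-step {ℂ = ℂ} {𝔸' = 𝔸′} e s e′) =
    sum-step (++-cong-≋ e ≋-refl) s (≋-trans (++-cong-≋ e′ ≋-refl) (≋-reflexive (++-assoc 𝔸′ ℂ 𝔻)))

  ⟶ts-++ˡ : {𝔸 𝔹 : Sum (Test n)} (𝔻 : Sum (Test n)) → 𝔸 ⟶ts 𝔹 → (𝔻 ++ 𝔸) ⟶ts (𝔻 ++ 𝔹)
  ⟶ts-++ˡ {𝔸} {𝔹} 𝔻 s = ⟶ts-respˡ-≋ (++-comm-≋ 𝔻 𝔸) (⟶ts-respʳ-≋ (++-comm-≋ 𝔻 𝔹) (⟶ts-++ʳ 𝔻 s))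

  ↠t-refl : {𝔸 : Sum (Test n)} → 𝔸 ↠t 𝔸
  ↠t-refl = _ , ε★ , ≋-refl

  ⟶t⇒↠t : {A : Test n} {𝔸 : Sum (Test n)} → A ⟶t 𝔸 → (A ∷ []) ↠t 𝔸
  ⟶t⇒↠t {𝔸 = 𝔸} s = _ , sum-step ≋-refl s (≋-reflexive (sym (++-identityʳ 𝔸))) ◅ ε★ , ≋-refl

  ↠t-respʳ-≋ : {𝔸 𝔹 𝔹′ : Sum (Test n)} → 𝔹 ≋ 𝔹′ → 𝔸 ↠t 𝔹 → 𝔸 ↠t 𝔹′
  ↠t-respʳ-≋ p (ℂ , s , e) = ℂ , s , ≋-trans e p

  ↠t-respˡ-≋ : {𝔸 𝔸′ 𝔹 : Sum (Test n)} → 𝔸′ ≋ 𝔸 → 𝔸 ↠t 𝔹 → 𝔸′ ↠t 𝔹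
  ↠t-respˡ-≋ p (_ , ε★ , e)     = _ , ε★ , ≋-trans p e
  ↠t-respˡ-≋ p (_ , s ◅ ss , e) = _ , ⟶ts-respˡ-≋ p s ◅ ss , e

  ↠t-trans : {𝔸 𝔹 ℂ : Sum (Test n)} → 𝔸 ↠t 𝔹 → 𝔹 ↠t ℂ → 𝔸 ↠t ℂ
  ↠t-trans (_ , s , e) r with ↠t-respˡ-≋ e r
  ... | _ , s′ , e′ = _ , s ◅◅ s′ , e′

  ↠t-++ : {𝔸 𝔹 𝔸′ 𝔹′ : Sum (Test n)} → 𝔸 ↠t 𝔹 → 𝔸′ ↠t 𝔹′ → (𝔸 ++ 𝔸′) ↠t (𝔹 ++ 𝔹′)
  ↠t-++ {𝔸′ = 𝔸′} (ℂ , s , e) (ℂ′ , s′ , e′) =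
    ℂ ++ ℂ′ , gmap (_++ 𝔸′) (⟶ts-++ʳ 𝔸′) s ◅◅ gmap (ℂ ++_) (⟶ts-++ˡ ℂ) s′ , ++-cong-≋ e e′

  ε-if : Bool → Sum (Test n)
  ε-if true  = ε ∷ []
  ε-if false = []

  ε-if-∨ : (b c : Bool) → (ε-if b ++ ε-if c) ≋ ε-if (b ∨ c)
  ε-if-∨ true  true  = (λ { (here refl) → here refl ; (there (here refl)) → here refl }) , there
  ε-if-∨ true  false = ≋-refl
  ε-if-∨ false c     = ≋-refl

  Evaluates : Sum (Test n) → Set
  Evaluates 𝔸 = ∃[ b ] 𝔸 ↠t ε-if b

  Evaluates-backward : {𝔸 𝔹 : Sum (Test n)} → 𝔸 ↠t 𝔹 → Evaluates 𝔹 → Evaluates 𝔸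
  Evaluates-backward r (b , r′) = b , ↠t-trans r r′

  Evaluates-sum : (𝔸 : Sum (Test n)) → (∀ {A} → A ∈ 𝔸 → Evaluates (A ∷ [])) → Evaluates 𝔸
  Evaluates-sum []      _  = false , ↠t-refl
  Evaluates-sum (A ∷ 𝔸) ev with ev (here refl) | Evaluates-sum 𝔸 (ev ∘ there)
  ... | b , r | c , rs = b ∨ c , ↠t-respʳ-≋ (ε-if-∨ b c) (↠t-++ r rs)

closed-test-evaluates : (A : Test 0) → Evaluates (A ∷ [])
closed-test-evaluates =
  WF.All.wfRec (On.wellFounded sizeL <-wellFounded) 0ℓ (λ A → Evaluates (A ∷ [])) evaluates-by-smaller
  where
  evaluates-by-smaller : (A : Test 0) →
                         (∀ {B} → sizeL B < sizeL A → Evaluates (B ∷ [])) → Evaluates (A ∷ [])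
  evaluates-by-smaller []      _  = true , ↠t-refl
  evaluates-by-smaller (L ∷ W) ih with closed-test-shrinks L W
  ... | 𝕍 , step , smaller = Evaluates-backward (⟶t⇒↠t step) (Evaluates-sum 𝕍 (ih ∘ smaller))

lemma3p23 : (M : Term 0) →
    ((M ∷ []) ∷ []) ↠t (ε ∷ []) ⊎ ((M ∷ []) ∷ []) ↠t []
lemma3p23 M with closed-test-evaluates (M ∷ [])
... | true  , r = inj₁ r
... | false , r = inj₂ r
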